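{- For $n\ge 4$, the cost of 2-distinguishing the folded hypercube satisfies $\rho(FQ_n)=O(n\lg n)$.
   Context: $\lg=\log_2$. The folded hypercube $FQ_n$ has vertex set $\mathbb{Z}_2^n$, two vertices being adjacent iff they differ in exactly one position or in all $n$ positions; for $n\ge 4$ it admits a distinguishing coloring with 2 colors (a coloring such that the only automorphism preserving each color class is the identity). The cost $\rho(G)$ of a 2-distinguishable graph $G$ is the minimum size of a color class over all distinguishing 2-colorings of $G$. -}

module Defs where

open import Data.Nat using (ℕ; zero; suc; _+_; _≤_; _⊔_)
open import Data.Nat.Base using (_⊓_)
open import Data.Bool using (Bool; true; false; _≟_)
open import Data.Vec using (Vec; []; _∷_)
open import Data.List using (List; []; _∷_; map; _++_; length; filter)
open import Data.Product using (Σ; _×_; _,_)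
open import Data.Sum using (_⊎_)
open import Relation.Binary.PropositionalEquality using (_≡_)
open import Relation.Nullary using (¬_)
open import Function.Bundles using (_↔_; Inverse)

Vertex : ℕ → Set
Vertex n = Vec Bool n

allVertices : (n : ℕ) → List (Vertex n)
allVertices zero = [] ∷ []
allVertices (suc n) = map (true ∷_) (allVertices n) ++ map (false ∷_) (allVertices n)

hamming : {n : ℕ} → Vertex n → Vertex n → ℕ
hamming [] [] = 0
hamming (a ∷ u) (b ∷ v) with a ≟ b
... | Relation.Nullary.yes _ = hamming u v
... | Relation.Nullary.no _ = suc (hamming u v)

Adj : (n : ℕ) → Vertex n → Vertex n → Set
Adj n u v = (hamming u v ≡ 1) ⊎ (hamming u v ≡ n)

IsAutomorphism : (n : ℕ) → (Vertex n ↔ Vertex n) → Set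
IsAutomorphism n σ =
  ∀ u v → (Adj n u v → Adj n (Inverse.to σ u) (Inverse.to σ v))
        × (Adj n (Inverse.to σ u) (Inverse.to σ v) → Adj n u v)

Distinguishing : (n : ℕ) → (Vertex n → Bool) → Set
Distinguishing n c =
  (σ : Vertex n ↔ Vertex n) → IsAutomorphism n σ →
  (∀ v → c (Inverse.to σ v) ≡ c v) → ∀ v → Inverse.to σ v ≡ v

classSize : (n : ℕ) → (Vertex n → Bool) → Bool → ℕ
classSize n c b = length (filter (λ v → c v ≟ b) (allVertices n))

minClassSize : (n : ℕ) → (Vertex n → Bool) → ℕ
minClassSize n c = classSize n c true ⊓ classSize n c false

IsCost : (n : ℕ) → ℕ → Set
IsCost n r =
  Σ (Vertex n → Bool) (λ c → Distinguishing n c × minClassSize n c ≡ r)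
  × (∀ c → Distinguishing n c → r ≤ minClassSize n c)

-- Colour red the n vertices 1ʲ0ⁿ⁻ʲ (0 ≤ j < n) and x = 110…01; this class has n + 1 ≤ n lg n
-- elements.  The red vertices induce a tree: the path 0ⁿ, 10ⁿ⁻¹, …, 1ⁿ⁻¹0 with x pendant at 110…0,
-- i.e. a centre with legs of lengths 1, 2 and n − 3.  For n ≥ 6 the legs have different lengths,
-- so a colour-preserving automorphism fixes every red vertex.  In FQ_n (n ≥ 4) two vertices at
-- distance 2 have exactly two common neighbours, so the fixed points of an automorphism are closed
-- under completing squares a, a + eᵢ, a + eⱼ ↦ a + eᵢ + eⱼ, and from the red vertices this closure
-- reaches the whole cube.

module Submission where

open import Defs
open import Data.Nat using (ℕ; _*_; _≤_)
open import Data.Nat.Logarithm using (⌊log₂_⌋; ⌊log₂⌋-mono-≤; ⌊log₂[2^n]⌋≡n)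
open import Data.Product using (Σ)

open import Data.Bool using (Bool; true; false; not; _∨_; _≟_)
open import Data.Bool.Properties using (not-¬; not-involutive; ∨-zeroʳ)
open import Data.Empty using (⊥-elim)
open import Data.Fin as Fin using (Fin; toℕ; fromℕ<; fromℕ)
open import Data.Fin.Patterns using (0F; 1F; 2F)
open import Data.Fin.Properties
  using (¬∀⟶∃¬; any?; injective⇒≤; toℕ-injective; toℕ-fromℕ<; toℕ-fromℕ; toℕ<n)
open import Data.Nat as ℕ using (zero; suc; _+_; _∸_; _<_; z≤n; s≤s; ∣_-_∣)
open import Data.Nat.Properties
  using (suc-injective; m≤n⇒m≤1+n; 1+n≰n; <⇒≱; 0≢1+n; ≤-refl; <⇒≤; ≤∧≢⇒<; n≮n;
         ∣m-n∣≡0⇒m≡n; ∣m-n∣≤m⊔n; ∣-∣-identityʳ; ⊔-lub; <-irrefl; ≤-<-trans; ≤-trans; n≤1+n;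
         m≤n⇒∣m-n∣≡n∸m; m+n∸n≡m; ≤-antisym; ≮⇒≥;
         +-comm; +-suc; +-identityʳ; +-monoʳ-≤; *-monoʳ-≤; *-identityˡ; *-comm; m⊓n≤m; ≤-reflexive;
         module ≤-Reasoning)
open import Data.Product using (∃; _×_; _,_; proj₁; proj₂)
open import Data.Sum as Sum using (_⊎_; inj₁; inj₂)
open import Data.List using (List; filter; length; _++_) renaming ([] to []ᴸ; _∷_ to _∷ᴸ_)
open import Data.List.Properties using (filter-++; length-++)
open import Data.Vec using ([]; _∷_; lookup; updateAt; map; tabulate; replicate)
open import Data.Vec.Properties
  using (lookup∘updateAt; lookup∘updateAt′; updateAt-updateAt; updateAt-cong; updateAt-id;
         updateAt-commutes; lookup-map; tabulate∘lookup; tabulate-cong; lookup-replicate; ≡-dec)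
open import Function using (id; _∘_)
open import Function.Bundles using (_↔_; Inverse)
open import Relation.Binary.PropositionalEquality
open import Relation.Nullary using (¬_; yes; no; does)
open import Relation.Nullary.Decidable using (dec-true; True; toWitness)
open import Relation.Binary.Definitions using (DecidableEquality)

private
  variable
    n : ℕ

-- Flips, complements and Hamming distance

x≢not-x : ∀ {x} → x ≢ not x
x≢not-x = not-¬ refl

≢-at : (m : Fin n) {u v : Vertex n} → lookup u m ≡ not (lookup v m) → u ≢ v
≢-at m e refl = x≢not-x e

≗-lookup⇒≡ : (u v : Vertex n) → (∀ i → lookup u i ≡ lookup v i) → u ≡ v
≗-lookup⇒≡ u v u≗v = begin
  u                    ≡⟨ sym (tabulate∘lookup u) ⟩
  tabulate (lookup u)  ≡⟨ tabulate-cong u≗v ⟩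
  tabulate (lookup v)  ≡⟨ tabulate∘lookup v ⟩
  v                    ∎
  where open ≡-Reasoning

∃-∉-image : ∀ {m} → m < n → (f : Fin m → Fin n) → ∃ λ y → ∀ x → f x ≢ y
∃-∉-image {n} m<n f with ¬∀⟶∃¬ n (λ y → ∃ λ x → f x ≡ y) (λ y → any? λ x → f x Fin.≟ y) not-onto
  where
  not-onto : ¬ (∀ y → ∃ λ x → f x ≡ y)
  not-onto onto = <⇒≱ m<n (injective⇒≤ λ {y} {y′} e →
    trans (sym (proj₂ (onto y))) (trans (cong f e) (proj₂ (onto y′))))
... | y , y∉ = y , λ x fx≡y → y∉ (x , fx≡y)

flip : Fin n → Vertex n → Vertex n
flip i v = updateAt v i not

complement : Vertex n → Vertex n
complement = map not

lookup-flip : (i : Fin n) (v : Vertex n) → lookup (flip i v) i ≡ not (lookup v i)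
lookup-flip i v = lookup∘updateAt i v

lookup-flip-≢ : {i j : Fin n} → i ≢ j → (v : Vertex n) → lookup (flip j v) i ≡ lookup v i
lookup-flip-≢ {i = i} {j} i≢j v = lookup∘updateAt′ i j i≢j v

lookup-complement : (i : Fin n) (v : Vertex n) → lookup (complement v) i ≡ not (lookup v i)
lookup-complement i v = lookup-map i not v

flip-involutive : (i : Fin n) (v : Vertex n) → flip i (flip i v) ≡ v
flip-involutive i v = begin
  updateAt (updateAt v i not) i not  ≡⟨ updateAt-updateAt i v ⟩
  updateAt v i (not ∘ not)           ≡⟨ updateAt-cong i not-involutive v ⟩
  updateAt v i id                    ≡⟨ updateAt-id i v ⟩
  v                                  ∎
  where open ≡-Reasoning

flip-comm : {i j : Fin n} → i ≢ j → (v : Vertex n) → flip i (flip j v) ≡ flip j (flip i v)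
flip-comm {i = i} {j} i≢j v = updateAt-commutes i j i≢j v

hamming-refl : (u : Vertex n) → hamming u u ≡ 0
hamming-refl []          = refl
hamming-refl (true ∷ u)  = hamming-refl u
hamming-refl (false ∷ u) = hamming-refl u

hamming-sym : (u v : Vertex n) → hamming u v ≡ hamming v u
hamming-sym []          []          = refl
hamming-sym (true ∷ u)  (true ∷ v)  = hamming-sym u v
hamming-sym (true ∷ u)  (false ∷ v) = cong suc (hamming-sym u v)
hamming-sym (false ∷ u) (true ∷ v)  = cong suc (hamming-sym u v)
hamming-sym (false ∷ u) (false ∷ v) = hamming-sym u v

hamming≤n : (u v : Vertex n) → hamming u v ≤ n
hamming≤n []          []          = z≤n
hamming≤n (true ∷ u)  (true ∷ v)  = m≤n⇒m≤1+n (hamming≤n u v)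
hamming≤n (true ∷ u)  (false ∷ v) = s≤s (hamming≤n u v)
hamming≤n (false ∷ u) (true ∷ v)  = s≤s (hamming≤n u v)
hamming≤n (false ∷ u) (false ∷ v) = m≤n⇒m≤1+n (hamming≤n u v)

hamming≡0⇒≡ : (u v : Vertex n) → hamming u v ≡ 0 → u ≡ v
hamming≡0⇒≡ []          []          _ = refl
hamming≡0⇒≡ (true ∷ u)  (true ∷ v)  h = cong (true ∷_) (hamming≡0⇒≡ u v h)
hamming≡0⇒≡ (false ∷ u) (false ∷ v) h = cong (false ∷_) (hamming≡0⇒≡ u v h)

hamming-flip : (i : Fin n) (u : Vertex n) → hamming u (flip i u) ≡ 1
hamming-flip Fin.zero    (true ∷ u)  = cong suc (hamming-refl u)
hamming-flip Fin.zero    (false ∷ u) = cong suc (hamming-refl u)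
hamming-flip (Fin.suc i) (true ∷ u)  = hamming-flip i u
hamming-flip (Fin.suc i) (false ∷ u) = hamming-flip i u

hamming-flip-agreeing : (u v : Vertex n) (p : Fin n) → lookup u p ≡ lookup v p →
                        hamming u (flip p v) ≡ suc (hamming u v)
hamming-flip-agreeing (true ∷ u)  (true ∷ v)  Fin.zero    _ = refl
hamming-flip-agreeing (false ∷ u) (false ∷ v) Fin.zero    _ = refl
hamming-flip-agreeing (true ∷ u)  (true ∷ v)  (Fin.suc p) e = hamming-flip-agreeing u v p e
hamming-flip-agreeing (true ∷ u)  (false ∷ v) (Fin.suc p) e = cong suc (hamming-flip-agreeing u v p e)
hamming-flip-agreeing (false ∷ u) (true ∷ v)  (Fin.suc p) e = cong suc (hamming-flip-agreeing u v p e)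
hamming-flip-agreeing (false ∷ u) (false ∷ v) (Fin.suc p) e = hamming-flip-agreeing u v p e

hamming≡1⇒flip : (u v : Vertex n) → hamming u v ≡ 1 → ∃ λ i → v ≡ flip i u
hamming≡1⇒flip []          []          ()
hamming≡1⇒flip (true ∷ u)  (true ∷ v)  h with i , e ← hamming≡1⇒flip u v h = Fin.suc i , cong (true ∷_) e
hamming≡1⇒flip (false ∷ u) (false ∷ v) h with i , e ← hamming≡1⇒flip u v h = Fin.suc i , cong (false ∷_) e
hamming≡1⇒flip (true ∷ u)  (false ∷ v) h = Fin.zero , cong (false ∷_) (sym (hamming≡0⇒≡ u v (suc-injective h)))
hamming≡1⇒flip (false ∷ u) (true ∷ v)  h = Fin.zero , cong (true ∷_) (sym (hamming≡0⇒≡ u v (suc-injective h)))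

hamming≡n⇒complement : (u v : Vertex n) → hamming u v ≡ n → v ≡ complement u
hamming≡n⇒complement []          []          _ = refl
hamming≡n⇒complement (true ∷ u)  (false ∷ v) h = cong (false ∷_) (hamming≡n⇒complement u v (suc-injective h))
hamming≡n⇒complement (false ∷ u) (true ∷ v)  h = cong (true ∷_) (hamming≡n⇒complement u v (suc-injective h))
hamming≡n⇒complement (true ∷ u)  (true ∷ v)  h = ⊥-elim (1+n≰n (subst (_≤ _) h (hamming≤n u v)))
hamming≡n⇒complement (false ∷ u) (false ∷ v) h = ⊥-elim (1+n≰n (subst (_≤ _) h (hamming≤n u v)))

hamming≡suc⇒flip-closer : (u s : Vertex n) {d : ℕ} → hamming u s ≡ suc d →
  ∃ λ m → lookup u m ≢ lookup s m × hamming (flip m u) s ≡ d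
hamming≡suc⇒flip-closer []          []          ()
hamming≡suc⇒flip-closer (true ∷ u)  (true ∷ s)  h with m , ne , h′ ← hamming≡suc⇒flip-closer u s h =
  Fin.suc m , ne , h′
hamming≡suc⇒flip-closer (false ∷ u) (false ∷ s) h with m , ne , h′ ← hamming≡suc⇒flip-closer u s h =
  Fin.suc m , ne , h′
hamming≡suc⇒flip-closer (true ∷ u)  (false ∷ s) h = Fin.zero , (λ ()) , suc-injective h
hamming≡suc⇒flip-closer (false ∷ u) (true ∷ s)  h = Fin.zero , (λ ()) , suc-injective h

Adj-sym : (u v : Vertex n) → Adj n u v → Adj n v u
Adj-sym u v (inj₁ h) = inj₁ (trans (hamming-sym v u) h)
Adj-sym u v (inj₂ h) = inj₂ (trans (hamming-sym v u) h)

Adj-flip : (i : Fin n) (u : Vertex n) → Adj n u (flip i u)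
Adj-flip i u = inj₁ (hamming-flip i u)

Adj-irreflexive : (u : Vertex (suc n)) → ¬ Adj (suc n) u u
Adj-irreflexive u (inj₁ h) = 0≢1+n (trans (sym (hamming-refl u)) h)
Adj-irreflexive u (inj₂ h) = 0≢1+n (trans (sym (hamming-refl u)) h)

Adj⇒flip⊎complement : (u v : Vertex n) → Adj n u v → (∃ λ i → v ≡ flip i u) ⊎ v ≡ complement u
Adj⇒flip⊎complement u v (inj₁ h) = inj₁ (hamming≡1⇒flip u v h)
Adj⇒flip⊎complement u v (inj₂ h) = inj₂ (hamming≡n⇒complement u v h)

-- Common neighbours in FQ_n

lookup-flip-flip-≢ : {k i m : Fin n} → m ≢ k → m ≢ i → (a : Vertex n) →
                     lookup (flip k (flip i a)) m ≡ lookup a m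
lookup-flip-flip-≢ {i = i} m≢k m≢i a = trans (lookup-flip-≢ m≢k (flip i a)) (lookup-flip-≢ m≢i a)

flip²≢complement : 3 < n → (k i j : Fin n) (a : Vertex n) → flip k (flip i a) ≢ complement (flip j a)
flip²≢complement 3<n k i j a with m , m∉ ← ∃-∉-image 3<n (lookup (k ∷ i ∷ j ∷ []))
  = ≢-at m (begin
      lookup (flip k (flip i a)) m      ≡⟨ lookup-flip-flip-≢ (m∉ 0F ∘ sym) (m∉ 1F ∘ sym) a ⟩
      lookup a m                        ≡⟨ not-involutive _ ⟨
      not (not (lookup a m))            ≡⟨ cong (not ∘ not) (lookup-flip-≢ (m∉ 2F ∘ sym) a) ⟨
      not (not (lookup (flip j a) m))   ≡⟨ cong not (lookup-complement m (flip j a)) ⟨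
      not (lookup (complement (flip j a)) m) ∎)
  where open ≡-Reasoning

module _ {i j : Fin n} (i≢j : i ≢ j) (a : Vertex n) where

  flip²≡flip²⇒ : {k l : Fin n} → flip k (flip i a) ≡ flip l (flip j a) →
                 flip k (flip i a) ≡ a ⊎ flip k (flip i a) ≡ flip i (flip j a)
  flip²≡flip²⇒ {k} {l} e with k Fin.≟ i | k Fin.≟ j
  ... | yes refl | _        = inj₁ (flip-involutive k a)
  ... | no _     | yes refl = inj₂ (flip-comm (i≢j ∘ sym) a)
  ... | no k≢i   | no k≢j with l Fin.≟ i
  ...   | no l≢i   = ⊥-elim (≢-at i (begin
            lookup (flip k (flip i a)) i  ≡⟨ lookup-flip-≢ (k≢i ∘ sym) (flip i a) ⟩
            lookup (flip i a) i           ≡⟨ lookup-flip i a ⟩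
            not (lookup a i)              ≡⟨ cong not (lookup-flip-flip-≢ (l≢i ∘ sym) i≢j a) ⟨
            not (lookup (flip l (flip j a)) i) ∎) e)
    where open ≡-Reasoning
  ...   | yes refl = ⊥-elim (≢-at k (begin
            lookup (flip k (flip l a)) k  ≡⟨ lookup-flip k (flip l a) ⟩
            not (lookup (flip l a) k)     ≡⟨ cong not (lookup-flip-≢ k≢i a) ⟩
            not (lookup a k)              ≡⟨ cong not (lookup-flip-flip-≢ k≢i k≢j a) ⟨
            not (lookup (flip l (flip j a)) k) ∎) e)
    where open ≡-Reasoning

  complement-flip-≢ : complement (flip i a) ≢ complement (flip j a)
  complement-flip-≢ = ≢-at i (begin
    lookup (complement (flip i a)) i   ≡⟨ lookup-complement i (flip i a) ⟩
    not (lookup (flip i a) i)          ≡⟨ cong not (lookup-flip i a) ⟩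
    not (not (lookup a i))             ≡⟨ cong (not ∘ not) (lookup-flip-≢ i≢j a) ⟨
    not (not (lookup (flip j a) i))    ≡⟨ cong not (lookup-complement i (flip j a)) ⟨
    not (lookup (complement (flip j a)) i) ∎)
    where open ≡-Reasoning

  common-neighbours : 3 < n → (y : Vertex n) → Adj n (flip i a) y → Adj n (flip j a) y →
                      y ≡ a ⊎ y ≡ flip i (flip j a)
  common-neighbours 3<n y yi yj
    with Adj⇒flip⊎complement _ y yi | Adj⇒flip⊎complement _ y yj
  ... | inj₁ (k , eᵢ) | inj₁ (l , eⱼ) = Sum.map (trans eᵢ) (trans eᵢ) (flip²≡flip²⇒ (trans (sym eᵢ) eⱼ))
  ... | inj₁ (k , eᵢ) | inj₂ eⱼ       = ⊥-elim (flip²≢complement 3<n k i j a (trans (sym eᵢ) eⱼ))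
  ... | inj₂ eᵢ       | inj₁ (l , eⱼ) = ⊥-elim (flip²≢complement 3<n l j i a (trans (sym eⱼ) eᵢ))
  ... | inj₂ eᵢ       | inj₂ eⱼ       = ⊥-elim (complement-flip-≢ (trans (sym eᵢ) eⱼ))

-- Filling the cube by squares

Below : ℕ → Vertex n → Set
Below {n} p u = (m : Fin n) → p ≤ toℕ m → lookup u m ≡ false

Below-flip : {p : ℕ} {m : Fin n} → ¬ p ≤ toℕ m → (u : Vertex n) → Below p u → Below p (flip m u)
Below-flip p≰m u below m′ p≤m′ =
  trans (lookup-flip-≢ (λ { refl → p≰m p≤m′ }) u) (below m′ p≤m′)

Below-suc : (q : Fin n) (u : Vertex n) → Below (suc (toℕ q)) u → lookup u q ≡ false → Below (toℕ q) u
Below-suc q u below uq≡false m q≤m with toℕ q ℕ.≟ toℕ m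
... | yes q≡m = subst (λ z → lookup u z ≡ false) (toℕ-injective q≡m) uq≡false
... | no  q≢m = below m (≤∧≢⇒< q≤m q≢m)

Below-0 : (u : Vertex n) → Below 0 u → u ≡ replicate n false
Below-0 u below = ≗-lookup⇒≡ u _ λ m → trans (below m z≤n) (sym (lookup-replicate m false))

SquareClosed : (Vertex n → Set) → Set
SquareClosed {n} F =
  {i j : Fin n} → i ≢ j → ∀ a → F a → F (flip i a) → F (flip j a) → F (flip i (flip j a))

Seeded : (Vertex n → Set) → Set
Seeded {n} F = (p : Fin n) → ∃ λ s → Below (toℕ p) s × F (flip p s)

module _ {n : ℕ} {F : Vertex n → Set} (closed : SquareClosed F) where

  -- Walking from the seed s to u inside the subcube, each step is one square.
  flip-spreads : (p : Fin n) → (∀ u → Below (toℕ p) u → F u) →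
                 (s : Vertex n) → Below (toℕ p) s → F (flip p s) →
                 ∀ u → Below (toℕ p) u → F (flip p u)
  flip-spreads p inside s below-s Fps u below-u = walk (hamming u s) u below-u refl
    where
    walk : ∀ d u → Below (toℕ p) u → hamming u s ≡ d → F (flip p u)
    walk zero u _ h = subst (F ∘ flip p) (sym (hamming≡0⇒≡ u s h)) Fps
    walk (suc d) u below-u h with m , uₘ≢sₘ , h′ ← hamming≡suc⇒flip-closer u s h = subst F flip³ square
      where
      p≰m : ¬ toℕ p ≤ toℕ m
      p≰m p≤m = uₘ≢sₘ (trans (below-u m p≤m) (sym (below-s m p≤m)))
      u′ : Vertex n
      u′ = flip m u
      below-u′ : Below (toℕ p) u′
      below-u′ = Below-flip p≰m u below-u
      square : F (flip m (flip p u′))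
      square = closed (λ { refl → p≰m ≤-refl }) u′ (inside u′ below-u′)
        (subst F (sym (flip-involutive m u)) (inside u below-u)) (walk d u′ below-u′ h′)
      flip³ : flip m (flip p u′) ≡ flip p u
      flip³ = trans (flip-comm (λ { refl → p≰m ≤-refl }) u′) (cong (flip p) (flip-involutive m u))

  filling-step : Seeded F → (q : Fin n) → (∀ u → Below (toℕ q) u → F u) →
                 ∀ u → Below (suc (toℕ q)) u → F u
  filling-step seeds q inside u below with lookup u q in uq | seeds q
  ... | false | _                 = inside u (Below-suc q u below uq)
  ... | true  | s , below-s , Fqs = subst F (flip-involutive q u)
        (flip-spreads q inside s below-s Fqs (flip q u) (Below-suc q (flip q u) below-flip uq′))
    where
    below-flip : Below (suc (toℕ q)) (flip q u)
    below-flip = Below-flip (λ q+1≤q → n≮n _ q+1≤q) u below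
    uq′ : lookup (flip q u) q ≡ false
    uq′ = trans (lookup-flip q u) (cong not uq)

  square-closed-fills : F (replicate n false) → Seeded F → ∀ u → F u
  square-closed-fills F0 seeds u = fill n ≤-refl u λ m n≤m → ⊥-elim (<⇒≱ (toℕ<n m) n≤m)
    where
    fill : ∀ p → p ≤ n → ∀ u → Below p u → F u
    fill zero    _   u below = subst F (sym (Below-0 u below)) F0
    fill (suc p) p<n u below = filling-step seeds q inside u (subst (λ z → Below (suc z) u) (sym q≡p) below)
      where
      q = fromℕ< p<n
      q≡p : toℕ q ≡ p
      q≡p = toℕ-fromℕ< p<n
      inside : ∀ v → Below (toℕ q) v → F v
      inside v below-v = fill p (<⇒≤ p<n) v (subst (λ z → Below z v) q≡p below-v)

module Automorphism {n : ℕ} (σ : Vertex n ↔ Vertex n) (aut : IsAutomorphism n σ) where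

  open Inverse σ public using (to; from; strictlyInverseˡ; strictlyInverseʳ)

  to-injective : {u v : Vertex n} → to u ≡ to v → u ≡ v
  to-injective {u} {v} e = trans (sym (strictlyInverseʳ u)) (trans (cong from e) (strictlyInverseʳ v))

  to-Adj : {u v : Vertex n} → Adj n u v → Adj n (to u) (to v)
  to-Adj {u} {v} = proj₁ (aut u v)

  from-Adj : {u v : Vertex n} → Adj n u v → Adj n (from u) (from v)
  from-Adj {u} {v} uv = proj₂ (aut (from u) (from v))
    (subst₂ (Adj n) (sym (strictlyInverseˡ u)) (sym (strictlyInverseˡ v)) uv)

  to⇒from : {x y : Vertex n} → to x ≡ y → from y ≡ x
  to⇒from {x} refl = strictlyInverseʳ x

  from⇒to : {x y : Vertex n} → from y ≡ x → y ≡ to x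
  from⇒to {y = y} refl = sym (strictlyInverseˡ y)

  to-neighbour : {x y x′ : Vertex n} → Adj n x y → to x ≡ x′ → Adj n x′ (to y)
  to-neighbour adj refl = to-Adj adj

  from-neighbour : {x y x′ : Vertex n} → Adj n x y → from x ≡ x′ → Adj n x′ (from y)
  from-neighbour adj refl = from-Adj adj

  Fixed : Vertex n → Set
  Fixed v = to v ≡ v

  -- The common neighbours of flip i a and flip j a are a and flip i (flip j a); the image of
  -- the latter is one of them, and it cannot be a = to a.
  fixed-square-closed : 3 < n → SquareClosed Fixed
  fixed-square-closed 3<n {i} {j} i≢j a fixed-a fixed-i fixed-j
    with common-neighbours i≢j a 3<n (to (flip i (flip j a)))
           (to-neighbour (subst (Adj n (flip i a)) (flip-comm (i≢j ∘ sym) a) (Adj-flip j (flip i a))) fixed-i)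
           (to-neighbour (Adj-flip i (flip j a)) fixed-j)
  ... | inj₂ fixed = fixed
  ... | inj₁ ↦a = ⊥-elim (≢-at i (begin
          lookup (flip i (flip j a)) i  ≡⟨ lookup-flip i (flip j a) ⟩
          not (lookup (flip j a) i)     ≡⟨ cong not (lookup-flip-≢ i≢j a) ⟩
          not (lookup a i)              ∎) (to-injective (trans ↦a (sym fixed-a))))
    where open ≡-Reasoning

-- The colouring

unary : ℕ → (n : ℕ) → Vertex n
unary zero    n       = replicate n false
unary (suc j) zero    = []
unary (suc j) (suc n) = true ∷ unary j n

unary-Below : (j n : ℕ) → Below j (unary j n)
unary-Below zero    (suc n) m           _         = lookup-replicate m false
unary-Below (suc j) (suc n) (Fin.suc m) (s≤s j≤m) = unary-Below j n m j≤m

flip-unary : (p : Fin n) → flip p (unary (toℕ p) n) ≡ unary (suc (toℕ p)) n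
flip-unary Fin.zero    = refl
flip-unary (Fin.suc p) = cong (true ∷_) (flip-unary p)

hamming-unary : {n i j : ℕ} → i ≤ n → j ≤ n → hamming (unary i n) (unary j n) ≡ ∣ i - j ∣
hamming-unary {zero}  z≤n       z≤n       = refl
hamming-unary {suc n} {zero}  {zero}  _ _ = hamming-unary {n} {0} {0} z≤n z≤n
hamming-unary {suc n} {zero}  {suc j} _ (s≤s j≤n) = cong suc (hamming-unary z≤n j≤n)
hamming-unary {suc n} {suc i} {zero}  (s≤s i≤n) _ = cong suc (trans (hamming-unary i≤n z≤n) (∣-∣-identityʳ i))
hamming-unary {suc n} {suc i} {suc j} (s≤s i≤n) (s≤s j≤n) = hamming-unary i≤n j≤n

unary-injective : {n i j : ℕ} → i ≤ n → j ≤ n → unary i n ≡ unary j n → i ≡ j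
unary-injective {n} {i} {j} i≤n j≤n e = ∣m-n∣≡0⇒m≡n (begin
  ∣ i - j ∣                       ≡⟨ hamming-unary i≤n j≤n ⟨
  hamming (unary i n) (unary j n) ≡⟨ cong (hamming (unary i n)) e ⟨
  hamming (unary i n) (unary i n) ≡⟨ hamming-refl (unary i n) ⟩
  0                               ∎)
  where open ≡-Reasoning

∣m-n∣≡1⇒ : {i j : ℕ} → ∣ i - j ∣ ≡ 1 → j ≡ suc i ⊎ i ≡ suc j
∣m-n∣≡1⇒ {zero}     {suc zero} _ = inj₁ refl
∣m-n∣≡1⇒ {suc zero} {zero}     _ = inj₂ refl
∣m-n∣≡1⇒ {suc i}    {suc j}    e = Sum.map (cong suc) (cong suc) (∣m-n∣≡1⇒ e)

Adj-unary⇒ : {n i j : ℕ} → i < n → j < n → Adj n (unary i n) (unary j n) → j ≡ suc i ⊎ i ≡ suc j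
Adj-unary⇒ i<n j<n (inj₁ h) = ∣m-n∣≡1⇒ (trans (sym (hamming-unary (<⇒≤ i<n) (<⇒≤ j<n))) h)
Adj-unary⇒ {i = i} {j} i<n j<n (inj₂ h) = ⊥-elim (<-irrefl
  (trans (sym (hamming-unary (<⇒≤ i<n) (<⇒≤ j<n))) h) (≤-<-trans (∣m-n∣≤m⊔n i j) (⊔-lub i<n j<n)))

Adj-unary-suc : {n i : ℕ} → suc i ≤ n → Adj n (unary i n) (unary (suc i) n)
Adj-unary-suc {i = i} i<n = inj₁ (begin
  hamming (unary i _) (unary (suc i) _) ≡⟨ hamming-unary (<⇒≤ i<n) i<n ⟩
  ∣ i - suc i ∣                          ≡⟨ m≤n⇒∣m-n∣≡n∸m (n≤1+n i) ⟩
  suc i ∸ i                              ≡⟨ m+n∸n≡m 1 i ⟩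
  1                                      ∎)
  where open ≡-Reasoning

corner : (m : ℕ) → Vertex (suc m)
corner m = flip (fromℕ m) (unary 2 (suc m))

hamming-unary-corner : {m k : ℕ} → 2 ≤ m → k ≤ m →
                       hamming (unary k (suc m)) (corner m) ≡ suc ∣ k - 2 ∣
hamming-unary-corner {m} {k} 2≤m k≤m = begin
  hamming (unary k (suc m)) (corner m)
    ≡⟨ hamming-flip-agreeing (unary k (suc m)) (unary 2 (suc m)) (fromℕ m) both-false ⟩
  suc (hamming (unary k (suc m)) (unary 2 (suc m)))
    ≡⟨ cong suc (hamming-unary (m≤n⇒m≤1+n k≤m) (m≤n⇒m≤1+n 2≤m)) ⟩
  suc ∣ k - 2 ∣
    ∎
  where
  open ≡-Reasoning
  below-last : ∀ {j} → j ≤ m → j ≤ toℕ (fromℕ m)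
  below-last j≤m = subst (_ ≤_) (sym (toℕ-fromℕ m)) j≤m
  both-false : lookup (unary k (suc m)) (fromℕ m) ≡ lookup (unary 2 (suc m)) (fromℕ m)
  both-false = trans (unary-Below k _ _ (below-last k≤m)) (sym (unary-Below 2 _ _ (below-last 2≤m)))

Adj-unary-corner : {m : ℕ} → 2 ≤ m → Adj (suc m) (unary 2 (suc m)) (corner m)
Adj-unary-corner 2≤m = inj₁ (hamming-unary-corner 2≤m 2≤m)

Adj-unary-corner⇒ : {m k : ℕ} → 3 ≤ m → k ≤ m → Adj (suc m) (unary k (suc m)) (corner m) → k ≡ 2
Adj-unary-corner⇒ 3≤m k≤m (inj₁ h) =
  ∣m-n∣≡0⇒m≡n (suc-injective (trans (sym (hamming-unary-corner (<⇒≤ 3≤m) k≤m)) h))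
Adj-unary-corner⇒ {m} {k} 3≤m k≤m (inj₂ h) =
  ⊥-elim (far k k≤m (suc-injective (trans (sym (hamming-unary-corner (<⇒≤ 3≤m) k≤m)) h)))
  where
  far : ∀ k → k ≤ m → ∣ k - 2 ∣ ≢ m
  far zero          _   e = <-irrefl e 3≤m
  far (suc zero)    _   e = <-irrefl e (≤-trans (s≤s (s≤s z≤n)) 3≤m)
  far (suc (suc k)) k≤m e = <-irrefl (trans (sym (∣-∣-identityʳ k)) e) (≤-trans (n≤1+n (suc k)) k≤m)

unary≢corner : {m k : ℕ} → 2 ≤ m → k ≤ m → unary k (suc m) ≢ corner m
unary≢corner {m} {k} 2≤m k≤m e = 0≢1+n (begin
  0                                    ≡⟨ hamming-refl (corner m) ⟨
  hamming (corner m) (corner m)        ≡⟨ cong (λ v → hamming v (corner m)) e ⟨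
  hamming (unary k (suc m)) (corner m) ≡⟨ hamming-unary-corner 2≤m k≤m ⟩
  suc ∣ k - 2 ∣                        ∎)
  where open ≡-Reasoning

_≟ᵛ_ : DecidableEquality (Vertex n)
_≟ᵛ_ = ≡-dec _≟_

isProperUnary : Vertex n → Bool
isProperUnary []          = false
isProperUnary (true ∷ v)  = isProperUnary v
isProperUnary (false ∷ v) = does (v ≟ᵛ replicate _ false)

isProperUnary-unary : {n j : ℕ} → j < n → isProperUnary (unary j n) ≡ true
isProperUnary-unary {suc n} {zero}  _         = dec-true (replicate n false ≟ᵛ replicate n false) refl
isProperUnary-unary {suc n} {suc j} (s≤s j<n) = isProperUnary-unary j<n

isProperUnary⇒ : (v : Vertex n) → isProperUnary v ≡ true → ∃ λ j → j < n × v ≡ unary j n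
isProperUnary⇒ (true ∷ v)  e with j , j<n , v≡ ← isProperUnary⇒ v e = suc j , s≤s j<n , cong (true ∷_) v≡
isProperUnary⇒ (false ∷ v) e with v ≟ᵛ replicate _ false
... | yes v≡0 = 0 , s≤s z≤n , cong (false ∷_) v≡0
isProperUnary⇒ (false ∷ v) () | no _

red : (m : ℕ) → Vertex (suc m) → Bool
red m v = isProperUnary v ∨ does (v ≟ᵛ corner m)

red-unary : {m j : ℕ} → j ≤ m → red m (unary j (suc m)) ≡ true
red-unary j≤m rewrite isProperUnary-unary (s≤s j≤m) = refl

red-corner : (m : ℕ) → red m (corner m) ≡ true
red-corner m rewrite dec-true (corner m ≟ᵛ corner m) refl = ∨-zeroʳ _

red⇒ : {m : ℕ} (v : Vertex (suc m)) → red m v ≡ true →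
       (∃ λ j → j ≤ m × v ≡ unary j (suc m)) ⊎ v ≡ corner m
red⇒ {m} v e with isProperUnary v in proper | v ≟ᵛ corner m
... | true  | _       with j , s≤s j≤m , v≡ ← isProperUnary⇒ v proper = inj₁ (j , j≤m , v≡)
... | false | yes v≡c = inj₂ v≡c
red⇒ v () | false | no _

-- Rigidity of the colouring

module RedNeighbours {m : ℕ} (3≤m : 3 ≤ m) where

  U : ℕ → Vertex (suc m)
  U j = unary j (suc m)

  Red : Vertex (suc m) → Set
  Red v = red m v ≡ true

  2≤m : 2 ≤ m
  2≤m = <⇒≤ 3≤m

  U-suc : {j : ℕ} → suc j ≤ m → Adj (suc m) (U j) (U (suc j))
  U-suc j<m = Adj-unary-suc (m≤n⇒m≤1+n j<m)

  U-pred : {j : ℕ} → suc j ≤ m → Adj (suc m) (U (suc j)) (U j)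
  U-pred {j} j<m = Adj-sym (U j) (U (suc j)) (U-suc j<m)

  U-injective : {i j : ℕ} → i ≤ m → j ≤ m → U i ≡ U j → i ≡ j
  U-injective i≤m j≤m = unary-injective (m≤n⇒m≤1+n i≤m) (m≤n⇒m≤1+n j≤m)

  red-neighbour-of-unary : {j : ℕ} → j ≤ m → {r : Vertex (suc m)} → Red r → Adj (suc m) (U j) r →
    (∃ λ i → i ≤ m × r ≡ U i × (i ≡ suc j ⊎ j ≡ suc i)) ⊎ (j ≡ 2 × r ≡ corner m)
  red-neighbour-of-unary j≤m {r} red-r adj with red⇒ r red-r
  ... | inj₁ (i , i≤m , refl) = inj₁ (i , i≤m , refl , Adj-unary⇒ (s≤s j≤m) (s≤s i≤m) adj)
  ... | inj₂ refl             = inj₂ (Adj-unary-corner⇒ 3≤m j≤m adj , refl)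

  red-neighbour-of-unary≢2 : {j : ℕ} → j ≤ m → j ≢ 2 → {r : Vertex (suc m)} → Red r → Adj (suc m) (U j) r →
    ∃ λ i → i ≤ m × r ≡ U i × (i ≡ suc j ⊎ j ≡ suc i)
  red-neighbour-of-unary≢2 j≤m j≢2 red-r adj with red-neighbour-of-unary j≤m red-r adj
  ... | inj₁ neighbour  = neighbour
  ... | inj₂ (j≡2 , _) = ⊥-elim (j≢2 j≡2)

  red-neighbour-of-corner : {r : Vertex (suc m)} → Red r → Adj (suc m) (corner m) r → r ≡ U 2
  red-neighbour-of-corner {r} red-r adj with red⇒ r red-r
  ... | inj₁ (i , i≤m , refl) = cong U (Adj-unary-corner⇒ 3≤m i≤m (Adj-sym (corner m) (U i) adj))
  ... | inj₂ refl             = ⊥-elim (Adj-irreflexive (corner m) adj)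

  at-most-two-red-neighbours : {j : ℕ} → j ≤ m → j ≢ 2 → {x y z : Vertex (suc m)} →
    Red x → Red y → Red z → Adj (suc m) (U j) x → Adj (suc m) (U j) y → Adj (suc m) (U j) z →
    x ≡ y ⊎ y ≡ z ⊎ x ≡ z
  at-most-two-red-neighbours j≤m j≢2 red-x red-y red-z adj-x adj-y adj-z
    with red-neighbour-of-unary≢2 j≤m j≢2 red-x adj-x
       | red-neighbour-of-unary≢2 j≤m j≢2 red-y adj-y
       | red-neighbour-of-unary≢2 j≤m j≢2 red-z adj-z
  ... | a , _ , refl , inj₁ refl | b , _ , refl , inj₁ refl | _ = inj₁ refl
  ... | a , _ , refl , inj₂ refl | b , _ , refl , inj₂ refl | _ = inj₁ refl
  ... | a , _ , refl , inj₁ refl | b , _ , refl , inj₂ refl | c , _ , refl , inj₁ refl = inj₂ (inj₂ refl)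
  ... | a , _ , refl , inj₁ refl | b , _ , refl , inj₂ refl | c , _ , refl , inj₂ refl = inj₂ (inj₁ refl)
  ... | a , _ , refl , inj₂ refl | b , _ , refl , inj₁ refl | c , _ , refl , inj₁ refl = inj₂ (inj₁ refl)
  ... | a , _ , refl , inj₂ refl | b , _ , refl , inj₁ refl | c , _ , refl , inj₂ refl = inj₂ (inj₂ refl)

module Rigidity {m : ℕ} (5≤m : 5 ≤ m) (σ : Vertex (suc m) ↔ Vertex (suc m)) (aut : IsAutomorphism (suc m) σ)
                (preserves : ∀ v → red m (Inverse.to σ v) ≡ red m v) where

  open Automorphism σ aut

  3≤m : 3 ≤ m
  3≤m = ≤-trans (s≤s (s≤s (s≤s z≤n))) 5≤m

  open RedNeighbours 3≤m

  C : Vertex (suc m)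
  C = corner m

  small : (j : ℕ) {j≤5 : True (j ℕ.≤? 5)} → j ≤ m
  small j {j≤5} = ≤-trans (toWitness j≤5) 5≤m

  to-Red : {v : Vertex (suc m)} → Red v → Red (to v)
  to-Red {v} red-v = trans (preserves v) red-v

  from-Red : {v : Vertex (suc m)} → Red v → Red (from v)
  from-Red {v} red-v = trans (sym (preserves (from v))) (trans (cong (red m) (strictlyInverseˡ v)) red-v)

  to-U-injective : {i j : ℕ} → i ≤ m → j ≤ m → to (U i) ≡ to (U j) → i ≡ j
  to-U-injective i≤m j≤m e = U-injective i≤m j≤m (to-injective e)

  to-U≢to-C : {i : ℕ} → i ≤ m → to (U i) ≢ to C
  to-U≢to-C i≤m e = unary≢corner 2≤m i≤m (to-injective e)

  -- unary 2 is the only red vertex with three red neighbours.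
  centre-fixed : Fixed (U 2)
  centre-fixed with red⇒ (to (U 2)) (to-Red (red-unary (small 2)))
  ... | inj₂ ↦C = ⊥-elim (1≢3 (to-U-injective (small 1) (small 3) (trans U1↦ (sym U3↦))))
    where
    U1↦ = red-neighbour-of-corner (to-Red (red-unary (small 1))) (to-neighbour (U-pred (small 2)) ↦C)
    U3↦ = red-neighbour-of-corner (to-Red (red-unary (small 3))) (to-neighbour (U-suc (small 3)) ↦C)
    1≢3 : 1 ≢ 3
    1≢3 ()
  ... | inj₁ (j , j≤m , ↦Uj) with j ℕ.≟ 2
  ...   | yes refl = ↦Uj
  ...   | no j≢2 with at-most-two-red-neighbours j≤m j≢2
                       (to-Red (red-unary (small 1))) (to-Red (red-unary (small 3))) (to-Red (red-corner m))
                       (to-neighbour (U-pred (small 2)) ↦Uj) (to-neighbour (U-suc (small 3)) ↦Uj)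
                       (to-neighbour (Adj-unary-corner 2≤m) ↦Uj)
  ...     | inj₁ U1≡U3        with () ← to-U-injective (small 1) (small 3) U1≡U3
  ...     | inj₂ (inj₁ U3≡C) = ⊥-elim (to-U≢to-C (small 3) U3≡C)
  ...     | inj₂ (inj₂ U1≡C) = ⊥-elim (to-U≢to-C (small 1) U1≡C)

  -- The corner is a leaf of the red tree, hanging at the centre.
  corner-not-to-leg : {k k′ : ℕ} → k′ ≤ m → k′ ≢ 2 → Adj (suc m) (U k) (U k′) → to C ≢ U k
  corner-not-to-leg {k′ = k′} k′≤m k′≢2 adj ↦Uk =
    k′≢2 (U-injective k′≤m (small 2) (trans (from⇒to U2↤Uk′) centre-fixed))
    where
    U2↤Uk′ : from (U k′) ≡ U 2
    U2↤Uk′ = red-neighbour-of-corner (from-Red (red-unary k′≤m)) (from-neighbour adj (to⇒from ↦Uk))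

  corner-fixed : Fixed C
  corner-fixed with red-neighbour-of-unary (small 2) (to-Red (red-corner m)) (to-neighbour (Adj-unary-corner 2≤m) centre-fixed)
  ... | inj₂ (_ , ↦C)                 = ↦C
  ... | inj₁ (_ , _ , ↦U3 , inj₁ refl) = ⊥-elim (corner-not-to-leg {3} (small 4) (λ ()) (U-suc (small 4)) ↦U3)
  ... | inj₁ (_ , _ , ↦U1 , inj₂ refl) = ⊥-elim (corner-not-to-leg {1} (small 0) (λ ()) (U-pred (small 1)) ↦U1)

  -- The leg through unary 1 has length 2, the one through unary 3 is longer.
  one-fixed : Fixed (U 1)
  one-fixed with red-neighbour-of-unary (small 2) (to-Red (red-unary (small 1))) (to-neighbour (U-pred (small 2)) centre-fixed)
  ... | inj₂ (_ , ↦C)                 = ⊥-elim (to-U≢to-C (small 1) (trans ↦C (sym corner-fixed)))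
  ... | inj₁ (_ , _ , ↦U1 , inj₂ refl) = ↦U1
  ... | inj₁ (_ , _ , ↦U3 , inj₁ refl)
    with red-neighbour-of-unary≢2 (small 3) (λ ()) (to-Red (red-unary (small 0))) (to-neighbour (U-pred (small 1)) ↦U3)
  ...   | _ , _ , ↦U2 , inj₂ refl with () ← to-U-injective (small 0) (small 2) (trans ↦U2 (sym centre-fixed))
  ...   | _ , _ , ↦U4 , inj₁ refl
    with red-neighbour-of-unary≢2 (small 0) (λ ()) (from-Red (red-unary (small 5)))
           (from-neighbour (U-suc (small 5)) (to⇒from ↦U4))
  ...     | _ , _ , U1↤U5 , inj₁ refl
    with () ← U-injective (small 5) (small 3) (trans (from⇒to U1↤U5) ↦U3)

  three-fixed : Fixed (U 3)
  three-fixed with red-neighbour-of-unary (small 2) (to-Red (red-unary (small 3))) (to-neighbour (U-suc (small 3)) centre-fixed)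
  ... | inj₂ (_ , ↦C)                 = ⊥-elim (to-U≢to-C (small 3) (trans ↦C (sym corner-fixed)))
  ... | inj₁ (_ , _ , ↦U3 , inj₁ refl) = ↦U3
  ... | inj₁ (_ , _ , ↦U1 , inj₂ refl) with () ← to-U-injective (small 3) (small 1) (trans ↦U1 (sym one-fixed))

  zero-fixed : Fixed (U 0)
  zero-fixed with red-neighbour-of-unary≢2 (small 1) (λ ()) (to-Red (red-unary (small 0)))
                    (to-neighbour (U-pred (small 1)) one-fixed)
  ... | _ , _ , ↦U0 , inj₂ refl = ↦U0
  ... | _ , _ , ↦U2 , inj₁ refl with () ← to-U-injective (small 0) (small 2) (trans ↦U2 (sym centre-fixed))

  leg-step : {j : ℕ} → 2 ≤ j → suc (suc j) ≤ m → Fixed (U j) → Fixed (U (suc j)) → Fixed (U (suc (suc j)))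
  leg-step {j} 2≤j j+2≤m fixed-j fixed-j+1
    with red-neighbour-of-unary≢2 j+1≤m j+1≢2 (to-Red (red-unary j+2≤m)) (to-neighbour (U-suc j+2≤m) fixed-j+1)
    where
    j+1≤m = ≤-trans (n≤1+n _) j+2≤m
    j+1≢2 : suc j ≢ 2
    j+1≢2 refl = <-irrefl refl 2≤j
  ... | _ , _ , ↦Uj+2 , inj₁ refl = ↦Uj+2
  ... | _ , _ , ↦Uj   , inj₂ refl = ⊥-elim (<-irrefl (sym j+2≡j) (s≤s (n≤1+n j)))
    where j+2≡j = to-U-injective j+2≤m (≤-trans (n≤1+n _) (≤-trans (n≤1+n _) j+2≤m)) (trans ↦Uj (sym fixed-j))

  unary-fixed : (j : ℕ) → j ≤ m → Fixed (U j)
  unary-fixed 0 _ = zero-fixed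
  unary-fixed 1 _ = one-fixed
  unary-fixed 2 _ = centre-fixed
  unary-fixed 3 _ = three-fixed
  unary-fixed (suc (suc (suc (suc j)))) j+4≤m =
    leg-step (s≤s (s≤s z≤n)) j+4≤m (unary-fixed (suc (suc j)) j+2≤m) (unary-fixed (suc (suc (suc j))) j+3≤m)
    where
    j+3≤m = ≤-trans (n≤1+n _) j+4≤m
    j+2≤m = ≤-trans (n≤1+n _) j+3≤m

  -- The last direction is reached through the corner, all others along the path.
  seed : Seeded Fixed
  seed p with suc (toℕ p) ℕ.≤? m
  ... | yes p<m = U (toℕ p) , unary-Below _ _ , subst Fixed (sym (flip-unary p)) (unary-fixed _ p<m)
  ... | no  p≮m = U 2 , (λ i p≤i → unary-Below 2 _ i (≤-trans 2≤p p≤i)) ,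
                  subst Fixed (cong (λ q → flip q (U 2)) (sym p≡last)) corner-fixed
    where
    p≡m : toℕ p ≡ m
    p≡m = ≤-antisym (ℕ.s≤s⁻¹ (toℕ<n p)) (≮⇒≥ p≮m)
    p≡last : p ≡ fromℕ m
    p≡last = toℕ-injective (trans p≡m (sym (toℕ-fromℕ m)))
    2≤p : 2 ≤ toℕ p
    2≤p = subst (2 ≤_) (sym p≡m) 2≤m

  rigid : ∀ v → to v ≡ v
  rigid = square-closed-fills (fixed-square-closed (s≤s 3≤m)) (unary-fixed 0 z≤n) seed

red-distinguishing : {m : ℕ} → 5 ≤ m → Distinguishing (suc m) (red m)
red-distinguishing 5≤m σ aut preserves = Rigidity.rigid 5≤m σ aut preserves

-- Size of the red class

count : {A : Set} → (A → Bool) → List A → ℕ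
count g xs = length (filter (λ x → g x ≟ true) xs)

count-++ : {A : Set} (g : A → Bool) (xs ys : List A) → count g (xs ++ ys) ≡ count g xs + count g ys
count-++ g xs ys = trans (cong length (filter-++ (λ x → g x ≟ true) xs ys)) (length-++ (filter (λ x → g x ≟ true) xs))

count-map : {A B : Set} (g : B → Bool) (h : A → B) (xs : List A) → count g (Data.List.map h xs) ≡ count (g ∘ h) xs
count-map g h []ᴸ = refl
count-map g h (x ∷ᴸ xs) with g (h x)
... | true  = cong suc (count-map g h xs)
... | false = count-map g h xs

count-∨ : {A : Set} (g h : A → Bool) (xs : List A) → count (λ x → g x ∨ h x) xs ≤ count g xs + count h xs
count-∨ g h []ᴸ = z≤n
count-∨ g h (x ∷ᴸ xs) with g x | h x
... | true  | true  = s≤s (≤-trans (count-∨ g h xs) (+-monoʳ-≤ (count g xs) (n≤1+n (count h xs))))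
... | true  | false = s≤s (count-∨ g h xs)
... | false | true  = subst (suc (count (λ x → g x ∨ h x) xs) ≤_) (sym (+-suc (count g xs) (count h xs)))
                             (s≤s (count-∨ g h xs))
... | false | false = count-∨ g h xs

count-false : {A : Set} (xs : List A) → count (λ _ → false) xs ≡ 0
count-false []ᴸ       = refl
count-false (x ∷ᴸ xs) = count-false xs

count-allVertices-suc : (n : ℕ) (g : Vertex (suc n) → Bool) → count g (allVertices (suc n)) ≡
  count (g ∘ (true ∷_)) (allVertices n) + count (g ∘ (false ∷_)) (allVertices n)
count-allVertices-suc n g = trans (count-++ g (Data.List.map (true ∷_) (allVertices n)) _)
  (cong₂ _+_ (count-map g (true ∷_) (allVertices n)) (count-map g (false ∷_) (allVertices n)))

count-≟ᵛ : (y : Vertex n) → count (λ v → does (v ≟ᵛ y)) (allVertices n) ≡ 1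
count-≟ᵛ []          = refl
count-≟ᵛ {suc n} (true ∷ y)  =
  trans (count-allVertices-suc n _) (cong₂ _+_ (count-≟ᵛ y) (count-false (allVertices n)))
count-≟ᵛ {suc n} (false ∷ y) =
  trans (count-allVertices-suc n _) (cong₂ _+_ (count-false (allVertices n)) (count-≟ᵛ y))

count-isProperUnary : (n : ℕ) → count isProperUnary (allVertices n) ≡ n
count-isProperUnary zero    = refl
count-isProperUnary (suc n) = begin
  count isProperUnary (allVertices (suc n))
    ≡⟨ count-allVertices-suc n isProperUnary ⟩
  count isProperUnary (allVertices n) + count (λ v → does (v ≟ᵛ replicate n false)) (allVertices n)
    ≡⟨ cong₂ _+_ (count-isProperUnary n) (count-≟ᵛ (replicate n false)) ⟩
  n + 1
    ≡⟨ +-comm n 1 ⟩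
  suc n
    ∎
  where open ≡-Reasoning

red-class-size : (m : ℕ) → classSize (suc m) (red m) true ≤ suc m + 1
red-class-size m = ≤-trans (count-∨ isProperUnary (λ v → does (v ≟ᵛ corner m)) (allVertices (suc m)))
  (≤-reflexive (cong₂ _+_ (count-isProperUnary (suc m)) (count-≟ᵛ (corner m))))

n+1≤n*⌊log₂n⌋ : 4 ≤ n → n + 1 ≤ n * ⌊log₂ n ⌋
n+1≤n*⌊log₂n⌋ {n} 4≤n = begin
  n + 1           ≤⟨ +-monoʳ-≤ n (≤-trans (s≤s z≤n) 4≤n) ⟩
  n + n           ≡⟨ cong (n +_) (+-identityʳ n) ⟨
  2 * n           ≡⟨ *-comm 2 n ⟩
  n * 2           ≤⟨ *-monoʳ-≤ n 2≤⌊log₂n⌋ ⟩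
  n * ⌊log₂ n ⌋   ∎
  where
  open ≤-Reasoning
  2≤⌊log₂n⌋ : 2 ≤ ⌊log₂ n ⌋
  2≤⌊log₂n⌋ = subst (_≤ ⌊log₂ n ⌋) (⌊log₂[2^n]⌋≡n 2) (⌊log₂⌋-mono-≤ 4≤n)

corollary5p8 : Σ ℕ (λ C → Σ ℕ (λ N →
    ∀ n → 4 ≤ n → N ≤ n → ∀ r → IsCost n r → r ≤ C * (n * ⌊log₂ n ⌋)))
corollary5p8 = 1 , 6 , cost-bound
  where
  open ≤-Reasoning
  cost-bound : ∀ n → 4 ≤ n → 6 ≤ n → ∀ r → IsCost n r → r ≤ 1 * (n * ⌊log₂ n ⌋)
  cost-bound (suc m) 4≤n (s≤s 5≤m) r (_ , minimal) = begin
    r                                 ≤⟨ minimal (red m) (red-distinguishing 5≤m) ⟩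
    minClassSize (suc m) (red m)      ≤⟨ m⊓n≤m _ _ ⟩
    classSize (suc m) (red m) true    ≤⟨ red-class-size m ⟩
    suc m + 1                         ≤⟨ n+1≤n*⌊log₂n⌋ 4≤n ⟩
    suc m * ⌊log₂ suc m ⌋             ≡⟨ *-identityˡ _ ⟨
    1 * (suc m * ⌊log₂ suc m ⌋)       ∎
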